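{- Let $k \ge 2$ be an even integer and let $D$ be a $k$-quasi-transitive digraph. If $P = (u = u_0, u_1, \dots, u_{k+1}, u_{k+2} = v)$ is a $uv$-path of minimum length in $D$ (so $d(u,v) = k+2$), then $d^+(v) \ge d^+(u) + k$.
   Context: All digraphs are finite, without loops and without multiple arcs in the same direction; paths are directed. $d(u,v)$ is the length of a shortest directed $uv$-path; $d^+(x)$ is the out-degree of $x$ in $D$. $D$ is $k$-quasi-transitive if for every directed path $(v_0, \dots, v_k)$ of length $k$, $(v_0,v_k) \in A(D)$ or $(v_k,v_0) \in A(D)$. -}

module Defs where

open import Data.Nat using (ℕ; suc; _+_; _<_)
open import Data.Fin using (Fin; zero; suc; inject₁; fromℕ)
open import Data.Bool using (Bool; true; false)
open import Data.List using (length; filterᵇ; allFin)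
open import Data.Product using (Σ; _×_; ∃)
open import Data.Sum using (_⊎_)
open import Relation.Binary.PropositionalEquality using (_≡_)
open import Relation.Nullary using (¬_)
open import Function.Definitions using (Injective)

record Digraph : Set where
  field
    n        : ℕ
    arc      : Fin n → Fin n → Bool
    loopless : ∀ x → arc x x ≡ false

open Digraph public

Arc : (D : Digraph) → Fin (n D) → Fin (n D) → Set
Arc D x y = arc D x y ≡ true

record Path (D : Digraph) (m : ℕ) : Set where
  field
    vtx      : Fin (suc m) → Fin (n D)
    distinct : Injective _≡_ _≡_ vtx
    arcs     : ∀ (i : Fin m) → Arc D (vtx (inject₁ i)) (vtx (suc i))

open Path public

start : ∀ {D m} → Path D m → Fin (n D)
start p = vtx p zero

end : ∀ {D m} → Path D m → Fin (n D)
end {m = m} p = vtx p (fromℕ m)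

PathFromTo : (D : Digraph) (m : ℕ) (u v : Fin (n D)) → Set
PathFromTo D m u v = Σ (Path D m) λ p → (start p ≡ u) × (end p ≡ v)

Dist≡ : (D : Digraph) (u v : Fin (n D)) (m : ℕ) → Set
Dist≡ D u v m = PathFromTo D m u v × (∀ l → l < m → ¬ PathFromTo D l u v)

QuasiTransitive : ℕ → Digraph → Set
QuasiTransitive k D = ∀ (p : Path D k) → Arc D (start p) (end p) ⊎ Arc D (end p) (start p)

outdeg : (D : Digraph) → Fin (n D) → ℕ
outdeg D x = length (filterᵇ (arc D x) (allFin (n D)))

-- Let u = u₀ u₁ … u_{k+2} = v be a shortest uv-path. A forward chord would shorten it, so
-- quasi-transitivity applied to its subpaths of length k yields the arcs u_k → u₀ and
-- v → u₂; in particular C = u₀ u₁ … u_k u₀ is a cycle of odd length k + 1. If v → u_s, the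
-- path v u_s u_{s+1} … of length k around C forces v → u_{s-2} (indices mod k + 1), so v
-- dominates all of C. For an out-neighbour w of u off the path, the path v u₃ … u_k u₀ w
-- gives v → w, as w → v would close a uv-path of length 2. Hence N⁺(u) ⊆ N⁺(v), and v has
-- the k further out-neighbours u₀, u₂, …, u_k, none of which u dominates.
module Submission where

open import Defs
open import Data.Nat using (ℕ; zero; suc; _+_; _*_; _≤_; _<_; _≤?_; z≤n; s≤s; NonZero)
open import Data.Nat.Properties hiding (_≟_)
open import Data.Nat.DivMod
  using (_%_; _mod_; m%n<n; m%n%n≡m%n; %-distribˡ-+; %-remove-+ˡ; m≤n⇒m%n≡m; n%n≡0; [m+n]%n≡m%n)
open import Data.Nat.Divisibility using (_∣_; divides; m∣m*n)
open import Data.Fin using (Fin; zero; suc; toℕ; fromℕ<; inject₁; punchIn)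
open import Data.Fin.Properties
  using (_≟_; toℕ-injective; toℕ-fromℕ; toℕ-fromℕ<; toℕ-inject₁; toℕ≤pred[n]; toℕ<n; injective⇒≤;
         punchIn-injective; punchInᵢ≢i)
open import Data.Bool using (Bool; true; false; _∧_; not; T)
open import Data.Bool.Properties using (T?; ∧-identityʳ)
open import Data.List using (List; []; _∷_; length; filterᵇ; lookup; allFin)
open import Data.List.Membership.Propositional using (_∈_)
open import Data.List.Membership.Propositional.Properties using (∈-filter⁺; ∈-allFin)
open import Data.List.Relation.Unary.Any using (index)
open import Data.List.Relation.Unary.Any.Properties using (lookup-index)
open import Data.Product using (Σ; _×_; _,_; ∃-syntax)
open import Data.Sum using (_⊎_; inj₁; inj₂; [_,_]′)
open import Data.Empty using (⊥-elim)
open import Relation.Nullary using (¬_; yes; no)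
open import Relation.Binary.Definitions using (tri<; tri≈; tri>)
open import Relation.Binary.PropositionalEquality
open import Function.Definitions using (Injective)
open import Function using (_∘_)

[m+n%d]%d≡[m+n]%d : ∀ m n d .{{_ : NonZero d}} → (m + n % d) % d ≡ (m + n) % d
[m+n%d]%d≡[m+n]%d m n d = begin
  (m + n % d) % d           ≡⟨ %-distribˡ-+ m (n % d) d ⟩
  (m % d + n % d % d) % d   ≡⟨ cong (λ x → (m % d + x) % d) (m%n%n≡m%n n d) ⟩
  (m % d + n % d) % d       ≡⟨ %-distribˡ-+ m n d ⟨
  (m + n) % d               ∎
  where open ≡-Reasoning

-- Adding m * s undoes the shift by s, since s + m * s = n * s where n = m + 1.
[s+i]%n≡[s+j]%n⇒i≡j : ∀ {n} .{{_ : NonZero n}} s {i j} → i < n → j < n → (s + i) % n ≡ (s + j) % n → i ≡ j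
[s+i]%n≡[s+j]%n⇒i≡j {suc m} s {i} {j} (s≤s i≤m) (s≤s j≤m) eq = begin
  i                                  ≡⟨ unshift i i≤m ⟨
  (m * s + (s + i) % suc m) % suc m  ≡⟨ cong (λ x → (m * s + x) % suc m) eq ⟩
  (m * s + (s + j) % suc m) % suc m  ≡⟨ unshift j j≤m ⟩
  j                                  ∎
  where
  open ≡-Reasoning
  unshift : ∀ x → x ≤ m → (m * s + (s + x) % suc m) % suc m ≡ x
  unshift x x≤m = begin
    (m * s + (s + x) % suc m) % suc m  ≡⟨ [m+n%d]%d≡[m+n]%d (m * s) (s + x) (suc m) ⟩
    (m * s + (s + x)) % suc m          ≡⟨ cong (_% suc m) (trans (sym (+-assoc (m * s) s x)) (cong (_+ x) (+-comm (m * s) s))) ⟩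
    (suc m * s + x) % suc m            ≡⟨ %-remove-+ˡ x (m∣m*n s) ⟩
    x % suc m                          ≡⟨ m≤n⇒m%n≡m x≤m ⟩
    x                                  ∎

length-filterᵇ-⊆ : ∀ {A : Set} (f g : A → Bool) (xs : List A) → (∀ x → f x ≡ true → g x ≡ true) →
  length (filterᵇ g xs) ≡ length (filterᵇ f xs) + length (filterᵇ (λ x → g x ∧ not (f x)) xs)
length-filterᵇ-⊆ f g [] f⊆g = refl
length-filterᵇ-⊆ f g (x ∷ xs) f⊆g with f x in fx | g x in gx
... | true  | true  = cong suc (length-filterᵇ-⊆ f g xs f⊆g)
... | true  | false with () ← trans (sym (f⊆g x fx)) gx
... | false | true  = trans (cong suc (length-filterᵇ-⊆ f g xs f⊆g)) (sym (+-suc _ _))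
... | false | false = length-filterᵇ-⊆ f g xs f⊆g

injection⇒≤-length-filterᵇ : ∀ {A : Set} {k} (f : A → Bool) (xs : List A) (h : Fin k → A) →
  Injective _≡_ _≡_ h → (∀ i → f (h i) ≡ true) → (∀ a → a ∈ xs) → k ≤ length (filterᵇ f xs)
injection⇒≤-length-filterᵇ f xs h h-injective fh complete = injective⇒≤ position-injective
  where
  member : ∀ i → h i ∈ filterᵇ f xs
  member i = ∈-filter⁺ (T? ∘ f) (complete (h i)) (subst T (sym (fh i)) _)
  position-injective : Injective _≡_ _≡_ (index ∘ member)
  position-injective {i} {j} eq = h-injective (begin
    h i                               ≡⟨ lookup-index (member i) ⟩
    lookup (filterᵇ f xs) (index (member i)) ≡⟨ cong (lookup (filterᵇ f xs)) eq ⟩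
    lookup (filterᵇ f xs) (index (member j)) ≡⟨ lookup-index (member j) ⟨
    h j                               ∎)
    where open ≡-Reasoning

outdeg-+-≤ : ∀ (D : Digraph) {x y k} → (∀ w → Arc D x w → Arc D y w) →
  (h : Fin k → Fin (n D)) → Injective _≡_ _≡_ h → (∀ i → Arc D y (h i)) → (∀ i → ¬ Arc D x (h i)) →
  outdeg D x + k ≤ outdeg D y
outdeg-+-≤ D {x} {y} {k} N⁺x⊆N⁺y h h-injective yh ¬xh = begin
  outdeg D x + k  ≤⟨ +-monoʳ-≤ (outdeg D x) (injection⇒≤-length-filterᵇ _ (allFin (n D)) h h-injective new ∈-allFin) ⟩
  outdeg D x + length (filterᵇ (λ w → arc D y w ∧ not (arc D x w)) (allFin (n D)))
                  ≡⟨ length-filterᵇ-⊆ (arc D x) (arc D y) (allFin (n D)) N⁺x⊆N⁺y ⟨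
  outdeg D y      ∎
  where
  open ≤-Reasoning
  new : ∀ i → arc D y (h i) ∧ not (arc D x (h i)) ≡ true
  new i with arc D x (h i) in xh
  ... | true  = ⊥-elim (¬xh i xh)
  ... | false = trans (∧-identityʳ _) (yh i)

¬Arc-refl : ∀ (D : Digraph) {x} → ¬ Arc D x x
¬Arc-refl D {x} xx with () ← trans (sym xx) (loopless D x)

toℕ-mod : ∀ {m j} → j ≤ m → toℕ (j mod suc m) ≡ j
toℕ-mod j≤m = trans (toℕ-fromℕ< _) (m≤n⇒m%n≡m j≤m)

-- A path of length m read as a sequence ℕ → vertices; only the values at 0 … m matter.
record ℕPath (D : Digraph) (m : ℕ) : Set where
  field
    at           : ℕ → Fin (n D)
    at-injective : ∀ {i j} → i ≤ m → j ≤ m → at i ≡ at j → i ≡ j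
    at-arc       : ∀ i → i < m → Arc D (at i) (at (suc i))

open ℕPath public

module _ {D : Digraph} where

  fromPath : ∀ {m} → Path D m → ℕPath D m
  fromPath {m} p = record { at = λ j → vtx p (j mod suc m) ; at-injective = injective ; at-arc = arc′ }
    where
    at-toℕ : ∀ x → vtx p (toℕ x mod suc m) ≡ vtx p x
    at-toℕ x = cong (vtx p) (toℕ-injective (toℕ-mod (toℕ≤pred[n] x)))
    injective : ∀ {i j} → i ≤ m → j ≤ m → vtx p (i mod suc m) ≡ vtx p (j mod suc m) → i ≡ j
    injective i≤m j≤m eq = trans (sym (toℕ-mod i≤m)) (trans (cong toℕ (distinct p eq)) (toℕ-mod j≤m))
    arc′ : ∀ i → i < m → Arc D (vtx p (i mod suc m)) (vtx p (suc i mod suc m))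
    arc′ i i<m = subst (λ j → Arc D (vtx p (j mod suc m)) (vtx p (suc j mod suc m))) (toℕ-fromℕ< i<m)
      (subst₂ (Arc D) (trans (sym (at-toℕ (inject₁ x))) (cong (λ j → vtx p (j mod suc m)) (toℕ-inject₁ x)))
                      (sym (at-toℕ (suc x))) (arcs p x))
      where x = fromℕ< i<m

  fromPath-end : ∀ {m} (p : Path D m) → at (fromPath p) m ≡ end p
  fromPath-end {m} p = cong (vtx p) (toℕ-injective (trans (toℕ-mod ≤-refl) (sym (toℕ-fromℕ m))))

  toPath : ∀ {m} (q : ℕPath D m) → PathFromTo D m (at q 0) (at q m)
  toPath {m} q = p , refl , cong (at q) (toℕ-fromℕ m)
    where
    p : Path D m
    vtx p x = at q (toℕ x)
    distinct p eq = toℕ-injective (at-injective q (toℕ≤pred[n] _) (toℕ≤pred[n] _) eq)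
    arcs p i = subst (λ j → Arc D (at q j) (at q (suc (toℕ i)))) (sym (toℕ-inject₁ i))
                 (at-arc q (toℕ i) (toℕ<n i))

  reindex : ∀ {m ℓ} (q : ℕPath D m) (σ : ℕ → ℕ) → (∀ {i} → i ≤ ℓ → σ i ≤ m) →
    (∀ {i j} → i ≤ ℓ → j ≤ ℓ → σ i ≡ σ j → i ≡ j) →
    (∀ i → i < ℓ → Arc D (at q (σ i)) (at q (σ (suc i)))) → ℕPath D ℓ
  at (reindex q σ _ _ _) = at q ∘ σ
  at-injective (reindex q σ σ≤m σ-injective _) i≤ℓ j≤ℓ eq =
    σ-injective i≤ℓ j≤ℓ (at-injective q (σ≤m i≤ℓ) (σ≤m j≤ℓ) eq)
  at-arc (reindex q σ _ _ σ-arc) = σ-arc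

  take : ∀ {m ℓ} → ℕPath D m → ℓ ≤ m → ℕPath D ℓ
  take q ℓ≤m = reindex q (λ i → i) (λ i≤ℓ → ≤-trans i≤ℓ ℓ≤m) (λ _ _ eq → eq)
    (λ i i<ℓ → at-arc q i (<-≤-trans i<ℓ ℓ≤m))

  segment : ∀ {m} (q : ℕPath D m) (s ℓ : ℕ) → ℓ + s ≤ m → ℕPath D ℓ
  segment q s ℓ ℓ+s≤m = reindex q (_+ s) (λ i≤ℓ → ≤-trans (+-monoˡ-≤ s i≤ℓ) ℓ+s≤m)
    (λ _ _ → +-cancelʳ-≡ _ _ _)
    (λ i i<ℓ → at-arc q (i + s) (<-≤-trans (+-monoˡ-< s i<ℓ) ℓ+s≤m))

  single : Fin (n D) → ℕPath D 0
  at (single x) _ = x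
  at-injective (single x) z≤n z≤n _ = refl
  at-arc (single x) _ ()

  prepend : ∀ {m} (x : Fin (n D)) (q : ℕPath D m) → Arc D x (at q 0) → (∀ i → i ≤ m → at q i ≢ x) →
    ℕPath D (suc m)
  at (prepend x q _ _) zero = x
  at (prepend x q _ _) (suc i) = at q i
  at-injective (prepend x q _ _) {zero} {zero} _ _ _ = refl
  at-injective (prepend x q _ fresh) {zero} {suc j} _ j≤m eq = ⊥-elim (fresh j (≤-pred j≤m) (sym eq))
  at-injective (prepend x q _ fresh) {suc i} {zero} i≤m _ eq = ⊥-elim (fresh i (≤-pred i≤m) eq)
  at-injective (prepend x q _ _) {suc i} {suc j} i≤m j≤m eq = cong suc (at-injective q (≤-pred i≤m) (≤-pred j≤m) eq)
  at-arc (prepend x q xq _) zero _ = xq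
  at-arc (prepend x q _ _) (suc i) i<m = at-arc q i (≤-pred i<m)

  module _ {m} (q : ℕPath D m) (x : Fin (n D)) (qx : Arc D (at q m) x) (fresh : ∀ i → i ≤ m → at q i ≢ x) where

    private
      extend : ℕ → Fin (n D)
      extend i with i ≤? m
      ... | yes _ = at q i
      ... | no _  = x

      extend-≤ : ∀ {i} → i ≤ m → extend i ≡ at q i
      extend-≤ {i} i≤m with i ≤? m
      ... | yes _   = refl
      ... | no i≰m = ⊥-elim (i≰m i≤m)

      extend-> : ∀ {i} → m < i → extend i ≡ x
      extend-> {i} m<i with i ≤? m
      ... | yes i≤m = ⊥-elim (<⇒≱ m<i i≤m)
      ... | no _    = refl

    append : ℕPath D (suc m)
    at append = extend
    at-injective append {i} {j} i≤ j≤ eq with m≤n⇒m<n∨m≡n i≤ | m≤n⇒m<n∨m≡n j≤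
    ... | inj₁ i<  | inj₁ j<  = at-injective q (≤-pred i<) (≤-pred j<)
                                  (trans (sym (extend-≤ (≤-pred i<))) (trans eq (extend-≤ (≤-pred j<))))
    ... | inj₁ i<  | inj₂ refl = ⊥-elim (fresh i (≤-pred i<)
                                  (trans (sym (extend-≤ (≤-pred i<))) (trans eq (extend-> ≤-refl))))
    ... | inj₂ refl | inj₁ j< = ⊥-elim (fresh j (≤-pred j<)
                                  (trans (sym (extend-≤ (≤-pred j<))) (trans (sym eq) (extend-> ≤-refl))))
    ... | inj₂ refl | inj₂ refl = refl
    at-arc append i i≤m with m≤n⇒m<n∨m≡n (≤-pred i≤m)
    ... | inj₁ i<m  = subst₂ (Arc D) (sym (extend-≤ (<⇒≤ i<m))) (sym (extend-≤ i<m)) (at-arc q i i<m)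
    ... | inj₂ refl = subst₂ (Arc D) (sym (extend-≤ ≤-refl)) (sym (extend-> ≤-refl)) qx

    append-end : at append (suc m) ≡ x
    append-end = extend-> ≤-refl

  on-path? : ∀ {m} (q : ℕPath D m) (x : Fin (n D)) → (∃[ i ] i ≤ m × at q i ≡ x) ⊎ (∀ i → i ≤ m → at q i ≢ x)
  on-path? {m} q x with anyUpTo? (λ i → at q i ≟ x) (suc m)
  ... | yes (i , i<1+m , qi≡x) = inj₁ (i , ≤-pred i<1+m , qi≡x)
  ... | no ¬on = inj₂ λ i i≤m qi≡x → ¬on (i , s≤s i≤m , qi≡x)

  quasiTransitive-ℕPath : ∀ {k} → QuasiTransitive k D → (q : ℕPath D k) →
    Arc D (at q 0) (at q k) ⊎ Arc D (at q k) (at q 0)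
  quasiTransitive-ℕPath qt q with toPath q
  ... | p , start≡ , end≡ with qt p
  ... | inj₁ forward  = inj₁ (subst₂ (Arc D) start≡ end≡ forward)
  ... | inj₂ backward = inj₂ (subst₂ (Arc D) end≡ start≡ backward)

  shortcut : ∀ {a e r} (q : ℕPath D (suc (suc a) + e + r)) → Arc D (at q a) (at q (suc (suc a) + e)) →
    PathFromTo D (suc a + r) (at q 0) (at q (suc (suc a) + e + r))
  shortcut {a} {e} {r} q chord = subst (PathFromTo D _ _) (cong (at q) skip-end) (toPath q′)
    where
    L : ℕ
    L = suc (suc a) + e + r
    a<L : a < L
    a<L = ≤-trans (n≤1+n (suc a)) (≤-trans (m≤m+n _ e) (m≤m+n _ r))
    skip : ℕ → ℕ
    skip i with i ≤? a
    ... | yes _ = i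
    ... | no _  = suc (i + e)
    skip-≤ : ∀ {i} → i ≤ a → skip i ≡ i
    skip-≤ {i} i≤a with i ≤? a
    ... | yes _   = refl
    ... | no i≰a = ⊥-elim (i≰a i≤a)
    skip-> : ∀ {i} → a < i → skip i ≡ suc (i + e)
    skip-> {i} a<i with i ≤? a
    ... | yes i≤a = ⊥-elim (<⇒≱ a<i i≤a)
    ... | no _    = refl
    +-swap : ∀ a r e → suc a + r + e ≡ suc a + e + r
    +-swap a r e = trans (+-assoc (suc a) r e) (trans (cong (suc a +_) (+-comm r e)) (sym (+-assoc (suc a) e r)))
    skip-end : skip (suc a + r) ≡ L
    skip-end = trans (skip-> (s≤s (m≤m+n a r))) (cong suc (+-swap a r e))
    skip-≤L : ∀ {i} → i ≤ suc a + r → skip i ≤ L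
    skip-≤L {i} i≤ with i ≤? a
    ... | yes i≤a = ≤-trans i≤a (<⇒≤ a<L)
    ... | no _    = ≤-trans (s≤s (+-monoˡ-≤ e i≤)) (≤-reflexive (cong suc (+-swap a r e)))
    below-skip : ∀ {i j} → i ≤ a → ¬ j ≤ a → i < suc (j + e)
    below-skip i≤a j≰a = s≤s (≤-trans i≤a (≤-trans (<⇒≤ (≰⇒> j≰a)) (m≤m+n _ e)))
    skip-injective : ∀ {i j} → skip i ≡ skip j → i ≡ j
    skip-injective {i} {j} eq with i ≤? a | j ≤? a
    ... | yes _   | yes _   = eq
    ... | no _    | no _    = +-cancelʳ-≡ e i j (suc-injective eq)
    ... | yes i≤a | no j≰a = ⊥-elim (<⇒≢ (below-skip i≤a j≰a) eq)
    ... | no i≰a | yes j≤a = ⊥-elim (<⇒≢ (below-skip j≤a i≰a) (sym eq))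
    skip-arc : ∀ i → i < suc a + r → Arc D (at q (skip i)) (at q (skip (suc i)))
    skip-arc i i< with <-cmp i a
    ... | tri< i<a _ _  = subst₂ (λ x y → Arc D (at q x) (at q y)) (sym (skip-≤ (<⇒≤ i<a))) (sym (skip-≤ i<a))
                            (at-arc q i (<-trans i<a a<L))
    ... | tri≈ _ refl _ = subst₂ (λ x y → Arc D (at q x) (at q y)) (sym (skip-≤ ≤-refl)) (sym (skip-> ≤-refl))
                            chord
    ... | tri> _ _ a<i  = subst₂ (λ x y → Arc D (at q x) (at q y)) (sym (skip-> a<i)) (sym (skip-> (m<n⇒m<1+n a<i)))
                            (at-arc q (suc (i + e)) (subst (_≤ L) (skip-> (m<n⇒m<1+n a<i)) (skip-≤L i<)))
    q′ : ℕPath D (suc a + r)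
    q′ = reindex q skip skip-≤L (λ _ _ → skip-injective) skip-arc

  IsGeodesic : ∀ {L} → ℕPath D L → Set
  IsGeodesic {L} q = ∀ l → l < L → ¬ PathFromTo D l (at q 0) (at q L)

  Dist≡⇒geodesic : ∀ {u v L} → Dist≡ D u v L → Σ (ℕPath D L) λ q → at q 0 ≡ u × at q L ≡ v × IsGeodesic q
  Dist≡⇒geodesic {u} {v} {L} ((p , p-start , p-end) , shortest) =
    q , p-start , q-end , λ l l<L (p′ , s , e) → shortest l l<L (p′ , trans s p-start , trans e q-end)
    where
    q : ℕPath D L
    q = fromPath p
    q-end : at q L ≡ v
    q-end = trans (fromPath-end p) p-end

  module Geodesic {L} (q : ℕPath D L) (geodesic : IsGeodesic q) where

    no-chord : ∀ {a b} → suc a < b → b ≤ L → ¬ Arc D (at q a) (at q b)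
    no-chord {a} a+1<b b≤L chord with m≤n⇒∃[o]m+o≡n a+1<b | m≤n⇒∃[o]m+o≡n b≤L
    ... | e , refl | r , refl = geodesic (suc a + r) (+-monoˡ-< r (s≤s (m≤m+n (suc a) e))) (shortcut {a} {e} {r} q chord)

    no-detour : ∀ {w} → 2 < L → (∀ i → i ≤ L → at q i ≢ w) → Arc D (at q 0) w → ¬ Arc D w (at q L)
    no-detour {w} 2<L off uw wv = geodesic 2 2<L (toPath (prepend (at q 0) (prepend w (single (at q L)) wv w≢v) uw fresh))
      where
      w≢v : ∀ i → i ≤ 0 → at q L ≢ w
      w≢v _ _ = off L ≤-refl
      fresh : ∀ i → i ≤ 1 → at (prepend w (single (at q L)) wv w≢v) i ≢ at q 0
      fresh zero    _ w≡u = off 0 z≤n (sym w≡u)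
      fresh (suc _) _ v≡u = n>0⇒n≢0 (<-trans (s≤s z≤n) 2<L) (at-injective q ≤-refl z≤n v≡u)

  module Cycle {m} (q : ℕPath D m) (closing : Arc D (at q m) (at q 0)) where

    private
      suc-% : ∀ j → suc (j % suc m) % suc m ≡ suc j % suc m
      suc-% j = [m+n%d]%d≡[m+n]%d 1 j (suc m)

    arc-% : ∀ j → Arc D (at q (j % suc m)) (at q (suc j % suc m))
    arc-% j with m≤n⇒m<n∨m≡n (≤-pred (m%n<n j (suc m)))
    ... | inj₁ r<m = subst (Arc D (at q (j % suc m)) ∘ at q) (trans (sym (m≤n⇒m%n≡m r<m)) (suc-% j)) (at-arc q _ r<m)
    ... | inj₂ r≡m = subst₂ (Arc D) (cong (at q) (sym r≡m)) (cong (at q) wraps) closing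
      where
      wraps : 0 ≡ suc j % suc m
      wraps = trans (sym (n%n≡0 (suc m))) (trans (cong (λ r → suc r % suc m) (sym r≡m)) (suc-% j))

    around : (s ℓ : ℕ) → ℓ ≤ m → ℕPath D ℓ
    around s ℓ ℓ≤m = reindex q (λ i → (s + i) % suc m) (λ {i} _ → ≤-pred (m%n<n (s + i) (suc m)))
      (λ i≤ℓ j≤ℓ → [s+i]%n≡[s+j]%n⇒i≡j s (s≤s (≤-trans i≤ℓ ℓ≤m)) (s≤s (≤-trans j≤ℓ ℓ≤m)))
      (λ i _ → subst (λ x → Arc D (at q ((s + i) % suc m)) (at q (x % suc m))) (sym (+-suc s i)) (arc-% (s + i)))

-- Here k = k₀ + 2 = 2h + 2 and u = u₀ u₁ … u_{k+2} = v is a shortest uv-path.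

module OutDegreeGap (k₀ h : ℕ) (k₀≡2h : k₀ ≡ h * 2) {D : Digraph} (qt : QuasiTransitive (suc (suc k₀)) D)
                    (q : ℕPath D (suc (suc (suc (suc k₀))))) (geodesic : IsGeodesic q) where

  open Geodesic q geodesic

  private
    k L : ℕ
    k = suc (suc k₀)
    L = 2 + k

    U : ℕ → Fin (n D)
    U = at q

    u v : Fin (n D)
    u = U 0
    v = U L

    2≤k : 2 ≤ k
    2≤k = s≤s (s≤s z≤n)

    k≤L : k ≤ L
    k≤L = ≤-trans (n≤1+n k) (n≤1+n (suc k))

    k+s≤L : ∀ {s} → s ≤ 2 → k + s ≤ L
    k+s≤L s≤2 = ≤-trans (+-monoʳ-≤ k s≤2) (≤-reflexive (+-comm k 2))

  back-arc : ∀ s → s ≤ 2 → Arc D (U (k + s)) (U s)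
  back-arc s s≤2 with quasiTransitive-ℕPath qt (segment q s k (k+s≤L s≤2))
  ... | inj₁ chord    = ⊥-elim (no-chord (+-monoˡ-≤ s 2≤k) (k+s≤L s≤2) chord)
  ... | inj₂ backward = backward

  open Cycle (take q k≤L) (subst (λ x → Arc D (U x) u) (+-identityʳ k) (back-arc 0 z≤n))

  -- Positions around the cycle u₀ u₁ … u_k u₀ are read mod k + 1.
  v→C : ℕ → Set
  v→C j = Arc D v (U (j % suc k))

  off-cycle : ∀ j → U (j % suc k) ≢ v
  off-cycle j eq =
    <⇒≢ (m<n⇒m<1+n (m%n<n j (suc k))) (at-injective q (≤-trans (≤-pred (m%n<n j (suc k))) k≤L) ≤-refl eq)

  step : ∀ s → v→C s → v→C (s + suc k₀)
  step s v→s with quasiTransitive-ℕPath qt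
                    (prepend v (around s (suc k₀) (n≤1+n (suc k₀))) v→s′ (λ i _ → off-cycle (s + i)))
    where
    v→s′ : Arc D v (U ((s + 0) % suc k))
    v→s′ = subst (λ x → Arc D v (U (x % suc k))) (sym (+-identityʳ s)) v→s
  ... | inj₁ forward  = forward
  ... | inj₂ backward = ⊥-elim (no-chord (s≤s (m%n<n (s + suc k₀) (suc k))) ≤-refl backward)

  step-back : ∀ j → v→C (2 + j) → v→C j
  step-back j v→2+j =
    subst (λ x → Arc D v (U x)) (trans (cong (_% suc k) shift) ([m+n]%n≡m%n j (suc k))) (step (2 + j) v→2+j)
    where
    shift : 2 + j + suc k₀ ≡ j + suc k
    shift = sym (trans (+-suc j (suc (suc k₀))) (cong suc (+-suc j (suc k₀))))

  descend : ∀ d j → v→C (d * 2 + j) → v→C j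
  descend zero    j v→j = v→j
  descend (suc d) j v→x = descend d j (step-back (d * 2 + j) v→x)

  fill-below : ∀ m j → j ≤ suc m → v→C m → v→C (suc m) → v→C j
  fill-below zero    zero          _        v→0 _   = v→0
  fill-below zero    (suc zero)    _        _   v→1 = v→1
  fill-below zero    (suc (suc _)) (s≤s ())
  fill-below (suc m) j             j≤2+m  v→1+m v→2+m with m≤n⇒m<n∨m≡n j≤2+m
  ... | inj₁ j<2+m = fill-below m j (≤-pred j<2+m) (step-back m v→2+m) v→1+m
  ... | inj₂ refl  = v→2+m

  v→C-≤ : ∀ j → j ≤ k → v→C j
  v→C-≤ j j≤k = fill-below (suc k₀) j j≤k v→C[k-1] v→C[k]
    where
    v→C[2] : v→C 2
    v→C[2] = subst₂ (λ x y → Arc D (U x) (U y)) (+-comm k 2) (sym (m≤n⇒m%n≡m 2≤k)) (back-arc 2 ≤-refl)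
    v→C[k-1] : v→C (suc k₀)
    v→C[k-1] = step 0 (step-back 0 v→C[2])
    -- k is even, so walking back from u_{k-1} in steps of 2 reaches u₁.
    v→C[1] : v→C 1
    v→C[1] = descend h 1 (subst v→C (trans (cong suc k₀≡2h) (+-comm 1 (h * 2))) v→C[k-1])
    v→C[k] : v→C k
    v→C[k] = step 1 v→C[1]

  v→C-all : ∀ j → v→C j
  v→C-all j = subst (λ x → Arc D v (U x)) (m%n%n≡m%n j (suc k)) (v→C-≤ (j % suc k) (≤-pred (m%n<n j (suc k))))

  v→U : ∀ {j} → j ≤ k → Arc D v (U j)
  v→U {j} j≤k = subst (λ x → Arc D v (U x)) (m≤n⇒m%n≡m j≤k) (v→C-≤ j j≤k)

  detour : ∀ w → (∀ i → i ≤ L → U i ≢ w) → Arc D u w → Arc D v w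
  detour w off uw =
    [ subst (Arc D v) path-end
    , (λ backward → ⊥-elim (no-detour (s≤s (s≤s (s≤s z≤n))) off uw
                               (subst (λ x → Arc D x v) path-end backward)))
    ]′ (quasiTransitive-ℕPath qt path)
    where
    q′ : ℕPath D (suc k₀)
    q′ = prepend v (around 3 k₀ (≤-trans (n≤1+n k₀) (n≤1+n (suc k₀)))) (v→C-all 3) (λ i _ → off-cycle (3 + i))
    u′w : Arc D (at q′ (suc k₀)) w
    u′w = subst (λ x → Arc D (U x) w) (sym (n%n≡0 (suc k))) uw
    fresh : ∀ i → i ≤ suc k₀ → at q′ i ≢ w
    fresh zero    _ = off L ≤-refl
    fresh (suc i) _ = off _ (≤-trans (≤-pred (m%n<n (3 + i) (suc k))) k≤L)
    path : ℕPath D k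
    path = append q′ w u′w fresh
    path-end : at path k ≡ w
    path-end = append-end q′ w u′w fresh

  N⁺u⊆N⁺v : ∀ w → Arc D u w → Arc D v w
  N⁺u⊆N⁺v w uw with on-path? q w
  ... | inj₁ (zero          , _   , refl) = ⊥-elim (¬Arc-refl D uw)
  ... | inj₁ (suc zero      , _   , refl) = v→U (s≤s z≤n)
  ... | inj₁ (suc (suc _)   , i≤L , refl) = ⊥-elim (no-chord (s≤s (s≤s z≤n)) i≤L uw)
  ... | inj₂ off                          = detour w off uw

  u↛U : ∀ j → j ≤ L → j ≢ 1 → ¬ Arc D u (U j)
  u↛U zero          _   _   = ¬Arc-refl D
  u↛U (suc zero)    _   j≢1 = ⊥-elim (j≢1 refl)
  u↛U (suc (suc _)) j≤L _   = no-chord (s≤s (s≤s z≤n)) j≤L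

  -- punchIn 1 enumerates the indices 0, 2, 3, …, k.
  new-out-neighbour : Fin k → Fin (n D)
  new-out-neighbour i = U (toℕ (punchIn (suc zero) i))

  out-degree-gap : outdeg D u + k ≤ outdeg D v
  out-degree-gap = outdeg-+-≤ D N⁺u⊆N⁺v new-out-neighbour injective
    (λ i → v→U (toℕ≤pred[n] (punchIn (suc zero) i)))
    (λ i → u↛U _ (index≤L i) (punchInᵢ≢i (suc zero) i ∘ toℕ-injective))
    where
    index≤L : ∀ i → toℕ (punchIn (suc zero) i) ≤ L
    index≤L i = ≤-trans (toℕ≤pred[n] (punchIn (suc zero) i)) k≤L
    injective : Injective _≡_ _≡_ new-out-neighbour
    injective {i} {j} eq = punchIn-injective (suc zero) i j (toℕ-injective (at-injective q (index≤L i) (index≤L j) eq))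

mainTheorem15 : (k : ℕ) → 2 ≤ k → 2 ∣ k → (D : Digraph) → QuasiTransitive k D →
    (u v : Fin (n D)) → Dist≡ D u v (k + 2) → outdeg D u + k ≤ outdeg D v
mainTheorem15 (suc (suc k₀)) (s≤s (s≤s z≤n)) (divides (suc h) k≡2[h+1]) D qt u v dist
  with q , q-start , q-end , geodesic ← Dist≡⇒geodesic (subst (Dist≡ D u v) (+-comm (suc (suc k₀)) 2) dist) =
  subst₂ (λ x y → outdeg D x + suc (suc k₀) ≤ outdeg D y) q-start q-end
    (OutDegreeGap.out-degree-gap k₀ h (suc-injective (suc-injective k≡2[h+1])) qt q geodesic)
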